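{- Let $\mathbb{T}^m=(\mathbb{F}_q^\ast)^m$. An affine transformation $T(x)=Ax+b$ ($A\in\mathbb{F}_q^{m\times m}$, $b\in\mathbb{F}_q^m$) satisfies $T(\mathbb{T}^m)=\mathbb{T}^m$ if and only if $b=0$ and $A=PD$, where $P$ is a permutation matrix and $D$ is a nonsingular diagonal matrix.
   Context: $T(\mathbb{T}^m)=\{AP+b : P\in\mathbb{T}^m\}$. -}

module Defs where

open import Level using (_⊔_) renaming (suc to lsuc)
open import Data.Nat using (ℕ; zero; suc)
open import Data.Fin using (Fin; zero; suc; _≟_)
open import Data.Fin.Permutation using (Permutation′; _⟨$⟩ʳ_)
open import Data.Product using (Σ; ∃; ∃-syntax; _×_; _,_)
open import Relation.Nullary using (¬_; yes; no)
open import Relation.Binary.Definitions using (Decidable)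
open import Relation.Binary.PropositionalEquality using (_≡_)
open import Algebra.Bundles using (CommutativeRing)

-- A finite field: a commutative ring (with setoid equality _≈_) in which
-- 1 ≉ 0, every nonzero element has a multiplicative inverse, equality is
-- decidable, and the carrier is in bijection (up to ≈) with Fin size.
-- size is the order q of the field.
record FiniteField c ℓ : Set (lsuc (c ⊔ ℓ)) where
  field
    commutativeRing : CommutativeRing c ℓ
  open CommutativeRing commutativeRing public
  field
    1≉0       : ¬ (1# ≈ 0#)
    inverse   : ∀ x → ¬ (x ≈ 0#) → ∃[ y ] (x * y ≈ 1#)
    _≈?_      : Decidable _≈_
    size      : ℕ
    enum      : Fin size → Carrier
    enum-surj : ∀ x → ∃[ i ] (enum i ≈ x)
    enum-inj  : ∀ i j → enum i ≈ enum j → i ≡ j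

module LinAlg {c ℓ} (F : FiniteField c ℓ) where
  open FiniteField F hiding (zero)

  Vector : ℕ → Set c
  Vector m = Fin m → Carrier

  Matrix : ℕ → ℕ → Set c
  Matrix m n = Fin m → Fin n → Carrier

  ∑ : ∀ n → (Fin n → Carrier) → Carrier
  ∑ zero    f = 0#
  ∑ (suc n) f = f zero + ∑ n (λ i → f (suc i))

  _≈ᵛ_ : ∀ {m} → Vector m → Vector m → Set ℓ
  u ≈ᵛ v = ∀ i → u i ≈ v i

  _≈ᴹ_ : ∀ {m n} → Matrix m n → Matrix m n → Set ℓ
  A ≈ᴹ B = ∀ i j → A i j ≈ B i j

  0ᵛ : ∀ {m} → Vector m
  0ᵛ _ = 0#

  _+ᵛ_ : ∀ {m} → Vector m → Vector m → Vector m
  (u +ᵛ v) i = u i + v i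

  _·ᵛ_ : ∀ {m n} → Matrix m n → Vector n → Vector m
  (A ·ᵛ x) i = ∑ _ (λ k → A i k * x k)

  _·ᴹ_ : ∀ {m n p} → Matrix m n → Matrix n p → Matrix m p
  (A ·ᴹ B) i j = ∑ _ (λ k → A i k * B k j)

  δ : ∀ {m} → Fin m → Fin m → Carrier
  δ i j with i ≟ j
  ... | yes _ = 1#
  ... | no  _ = 0#

  I : ∀ {m} → Matrix m m
  I = δ

  InTorus : ∀ {m} → Vector m → Set ℓ
  InTorus x = ∀ i → ¬ (x i ≈ 0#)

  affine : ∀ {m} → Matrix m m → Vector m → Vector m → Vector m
  affine A b x = (A ·ᵛ x) +ᵛ b

  MapsTorusOnto : ∀ {m} → Matrix m m → Vector m → Set (c ⊔ ℓ)
  MapsTorusOnto A b =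
    (∀ x → InTorus x → InTorus (affine A b x)) ×
    (∀ y → InTorus y → ∃[ x ] (InTorus x × affine A b x ≈ᵛ y))

  IsPermutationMatrix : ∀ {m} → Matrix m m → Set ℓ
  IsPermutationMatrix {m} P =
    Σ (Permutation′ m) λ π → ∀ i j → P i j ≈ δ (π ⟨$⟩ʳ i) j

  IsDiagonal : ∀ {m} → Matrix m m → Set ℓ
  IsDiagonal D = ∀ i j → ¬ (i ≡ j) → D i j ≈ 0#

  Nonsingular : ∀ {m} → Matrix m m → Set (c ⊔ ℓ)
  Nonsingular D = ∃[ E ] ((D ·ᴹ E) ≈ᴹ I × (E ·ᴹ D) ≈ᴹ I)

-- Write T(x) = Ax + b and fix a row i. The affine form x ↦ (Ax + b)_i has no zero
-- on the torus. If A_is ≠ 0, moving the single coordinate x_s (keeping it nonzero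
-- unless the form already equals A_is x_s) would produce a zero, so the form equals
-- A_is x_s on the whole torus. Since q ≥ 3 a coordinate can be moved from 1 to a
-- value other than 0 and 1, which forces every other entry of the row, and b_i, to
-- vanish: A is monomial and b = 0. Surjectivity rules out zero rows and two rows
-- supported in the same column, so the column map is a permutation and A = PD.
-- Conversely such a map permutes and rescales coordinates, hence preserves the torus.
module Submission where

open import Defs
open import Data.Nat as ℕ using (ℕ; _≤_; s≤s)
open import Data.Nat.Properties using (1+n≰n)
open import Data.Fin using (Fin; zero; suc; _≟_; punchOut)
open import Data.Fin.Properties using (suc-injective; punchOut-injective; injective⇒≤; any?; ¬∀⟶∃¬)
open import Data.Fin.Permutation using (Permutation′; _⟨$⟩ʳ_; _⟨$⟩ˡ_; permutation; inverseˡ)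
open import Level using (_⊔_)
open import Data.Product using (Σ; ∃-syntax; _×_; _,_; proj₁; proj₂)
open import Data.Sum using (_⊎_; inj₁; inj₂)
open import Data.Empty using (⊥-elim)
open import Relation.Nullary using (¬_; yes; no)
open import Relation.Nullary.Decidable using (decidable-stable)
import Relation.Binary.PropositionalEquality as ≡
open ≡ using (_≡_; _≢_)
open import Function.Definitions using (Injective; Surjective)
open import Function.Base using (case_of_; _∘_)
open import Function.Bundles using (_⇔_; mk⇔)

injective⇒surjective : ∀ {n} {f : Fin n → Fin n} → Injective _≡_ _≡_ f → Surjective _≡_ _≡_ f
injective⇒surjective {ℕ.zero}  _     ()
injective⇒surjective {ℕ.suc _} {f} f-inj k with any? (λ i → f i ≟ k)
... | yes (i , fi≡k) = i , λ { ≡.refl → fi≡k }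
... | no ¬hit = ⊥-elim (1+n≰n (injective⇒≤ g-inj))
  where
  f≢k : ∀ i → k ≢ f i
  f≢k i k≡fi = ¬hit (i , ≡.sym k≡fi)
  g : Fin _ → Fin _
  g i = punchOut (f≢k i)
  g-inj : Injective _≡_ _≡_ g
  g-inj {i} {j} gi≡gj = f-inj (punchOut-injective (f≢k i) (f≢k j) gi≡gj)

module _ {c ℓ} (F : FiniteField c ℓ) where
  open FiniteField F hiding (zero)
  open LinAlg F
  open import Algebra.Properties.Ring ring
    using (-‿involutive; +-identityʳ-unique; +-inverseˡ-unique; x∙y⁻¹≈ε⇒x≈y; //-rightDividesˡ)
  open import Algebra.Properties.CommutativeSemigroup *-commutativeSemigroup
    using (x∙yz≈y∙xz; xy∙z≈y∙xz)
  open import Algebra.Properties.CommutativeSemigroup +-commutativeSemigroup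
    using (interchange) renaming (xy∙z≈xz∙y to +-xy∙z≈xz∙y)
  open import Relation.Binary.Reasoning.Setoid setoid

  inv : (x : Carrier) → ¬ x ≈ 0# → Carrier
  inv x x≉0 = proj₁ (inverse x x≉0)

  *-inverseʳ : ∀ x (x≉0 : ¬ x ≈ 0#) → x * inv x x≉0 ≈ 1#
  *-inverseʳ x x≉0 = proj₂ (inverse x x≉0)

  inv≉0 : ∀ x (x≉0 : ¬ x ≈ 0#) → ¬ inv x x≉0 ≈ 0#
  inv≉0 x x≉0 inv≈0 = 1≉0 (trans (sym (*-inverseʳ x x≉0)) (trans (*-congˡ inv≈0) (zeroʳ x)))

  *-inv-cancel : ∀ {x} (x≉0 : ¬ x ≈ 0#) y → x * (inv x x≉0 * y) ≈ y
  *-inv-cancel {x} x≉0 y = begin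
    x * (inv x x≉0 * y)  ≈⟨ *-assoc x _ y ⟨
    (x * inv x x≉0) * y  ≈⟨ *-congʳ (*-inverseʳ x x≉0) ⟩
    1# * y               ≈⟨ *-identityˡ y ⟩
    y                    ∎

  inv-*-cancel : ∀ {x} (x≉0 : ¬ x ≈ 0#) y → inv x x≉0 * (x * y) ≈ y
  inv-*-cancel {x} x≉0 y = trans (x∙yz≈y∙xz _ x y) (*-inv-cancel x≉0 y)

  x*y≈0⇒y≈0 : ∀ {x y} → ¬ x ≈ 0# → x * y ≈ 0# → y ≈ 0#
  x*y≈0⇒y≈0 {x} {y} x≉0 xy≈0 =
    trans (sym (inv-*-cancel x≉0 y)) (trans (*-congˡ xy≈0) (zeroʳ _))

  x*y≈1⇒y≈inv : ∀ {x y} (x≉0 : ¬ x ≈ 0#) → x * y ≈ 1# → y ≈ inv x x≉0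
  x*y≈1⇒y≈inv {x} {y} x≉0 xy≈1 =
    trans (sym (inv-*-cancel x≉0 y)) (trans (*-congˡ xy≈1) (*-identityʳ _))

  x*y≈1⇒x≉0 : ∀ {x y} → x * y ≈ 1# → ¬ x ≈ 0#
  x*y≈1⇒x≉0 {x} {y} xy≈1 x≈0 = 1≉0 (trans (sym xy≈1) (trans (*-congʳ x≈0) (zeroˡ y)))

  *-nonzero : ∀ {x y} → ¬ x ≈ 0# → ¬ y ≈ 0# → ¬ x * y ≈ 0#
  *-nonzero x≉0 y≉0 xy≈0 = y≉0 (x*y≈0⇒y≈0 x≉0 xy≈0)

  one-of-two-avoids : ∀ {v w} → ¬ v ≈ w → ∀ d → ¬ v ≈ d ⊎ ¬ w ≈ d
  one-of-two-avoids {v} v≉w d with v ≈? d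
  ... | no v≉d = inj₁ v≉d
  ... | yes v≈d = inj₂ λ w≈d → v≉w (trans v≈d (sym w≈d))

  one-of-three-avoids-two : ∀ {u v w} → ¬ u ≈ v → ¬ u ≈ w → ¬ v ≈ w →
                            ∀ d e → ∃[ z ] (¬ z ≈ d × ¬ z ≈ e)
  one-of-three-avoids-two {u} {v} {w} u≉v u≉w v≉w d e with u ≈? d | u ≈? e
  ... | no u≉d | no u≉e = u , u≉d , u≉e
  ... | yes u≈d | _ with one-of-two-avoids v≉w e
  ...   | inj₁ v≉e = v , (λ v≈d → u≉v (trans u≈d (sym v≈d))) , v≉e
  ...   | inj₂ w≉e = w , (λ w≈d → u≉w (trans u≈d (sym w≈d))) , w≉e
  one-of-three-avoids-two {u} {v} {w} u≉v u≉w v≉w d e | no u≉d | yes u≈e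
    with one-of-two-avoids v≉w d
  ... | inj₁ v≉d = v , v≉d , λ v≈e → u≉v (trans u≈e (sym v≈e))
  ... | inj₂ w≉d = w , w≉d , λ w≈e → u≉w (trans u≈e (sym w≈e))

  nonzero-avoiding : 3 ≤ size → ∀ d → ∃[ u ] (¬ u ≈ 0# × ¬ u ≈ d)
  nonzero-avoiding q≥3 = avoid enum-inj q≥3 0#
    where
    avoid : ∀ {n} {e : Fin n → Carrier} → (∀ i j → e i ≈ e j → i ≡ j) → 3 ≤ n →
            ∀ d d′ → ∃[ z ] (¬ z ≈ d × ¬ z ≈ d′)
    avoid {e = e} e-inj (s≤s (s≤s (s≤s _))) =
      one-of-three-avoids-two {e zero} {e (suc zero)} {e (suc (suc zero))}
        (λ eq → case e-inj _ _ eq of λ ()) (λ eq → case e-inj _ _ eq of λ ()) (λ eq → case e-inj _ _ eq of λ ())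

  ∑-cong : ∀ n {f g : Fin n → Carrier} → (∀ k → f k ≈ g k) → ∑ n f ≈ ∑ n g
  ∑-cong ℕ.zero    f≈g = refl
  ∑-cong (ℕ.suc n) f≈g = +-cong (f≈g zero) (∑-cong n (λ k → f≈g (suc k)))

  ∑-zero : ∀ n {f : Fin n → Carrier} → (∀ k → f k ≈ 0#) → ∑ n f ≈ 0#
  ∑-zero ℕ.zero    f≈0 = refl
  ∑-zero (ℕ.suc n) f≈0 = trans (+-cong (f≈0 zero) (∑-zero n (λ k → f≈0 (suc k)))) (+-identityˡ 0#)

  ∑-distrib-+ : ∀ n (f g : Fin n → Carrier) → ∑ n (λ k → f k + g k) ≈ ∑ n f + ∑ n g
  ∑-distrib-+ ℕ.zero    f g = sym (+-identityˡ 0#)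
  ∑-distrib-+ (ℕ.suc n) f g = trans (+-congˡ (∑-distrib-+ n (λ k → f (suc k)) (λ k → g (suc k))))
    (interchange (f zero) (g zero) _ _)

  ∑-single-support : ∀ {n} {f : Fin n → Carrier} s → (∀ k → k ≢ s → f k ≈ 0#) → ∑ n f ≈ f s
  ∑-single-support {ℕ.suc n} zero    f≈0 =
    trans (+-congˡ (∑-zero n (λ k → f≈0 (suc k) λ ()))) (+-identityʳ _)
  ∑-single-support {ℕ.suc n} (suc s) f≈0 =
    trans (+-cong (f≈0 zero λ ()) (∑-single-support s (λ k k≢s → f≈0 (suc k) (k≢s ∘ suc-injective))))
          (+-identityˡ _)

  δ-refl : ∀ {n} (i : Fin n) → δ i i ≈ 1#
  δ-refl i with i ≟ i
  ... | yes _   = refl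
  ... | no  i≢i = ⊥-elim (i≢i ≡.refl)

  δ-≢ : ∀ {n} {i j : Fin n} → i ≢ j → δ i j ≈ 0#
  δ-≢ {i = i} {j} i≢j with i ≟ j
  ... | yes i≡j = ⊥-elim (i≢j i≡j)
  ... | no  _   = refl

  ∑-δ : ∀ {n} (i : Fin n) (f : Fin n → Carrier) → ∑ n (λ k → δ i k * f k) ≈ f i
  ∑-δ i f = trans (∑-single-support i (λ k k≢i → trans (*-congʳ (δ-≢ (k≢i ∘ ≡.sym))) (zeroˡ (f k))))
                  (trans (*-congʳ (δ-refl i)) (*-identityˡ (f i)))

  ∑-scaled-δ : ∀ {n} a (i : Fin n) (f : Fin n → Carrier) → ∑ n (λ k → (a * δ i k) * f k) ≈ a * f i
  ∑-scaled-δ a i f = trans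
    (∑-cong _ (λ k → xy∙z≈y∙xz a (δ i k) (f k)))
    (∑-δ i (λ k → a * f k))

  supported-at : ∀ {n} {f : Fin n → Carrier} s → (∀ k → k ≢ s → f k ≈ 0#) → ∀ j → f j ≈ f s * δ s j
  supported-at s f≈0 j with s ≟ j
  ... | yes ≡.refl = sym (*-identityʳ _)
  ... | no  s≢j    = trans (f≈0 j (s≢j ∘ ≡.sym)) (sym (zeroʳ _))

  IsMonomial : ∀ {m} → (Fin m → Fin m) → Vector m → Matrix m m → Set ℓ
  IsMonomial ρ a A = ∀ i j → A i j ≈ a i * δ (ρ i) j

  Monomial : ∀ {m} → Matrix m m → Set (c ⊔ ℓ)
  Monomial {m} A = Σ (Permutation′ m) λ π → ∃[ a ] ((∀ i → ¬ a i ≈ 0#) × IsMonomial (π ⟨$⟩ʳ_) a A)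

  PermutationTimesDiagonal : ∀ {m} → Matrix m m → Set (c ⊔ ℓ)
  PermutationTimesDiagonal A =
    ∃[ P ] ∃[ D ] (IsPermutationMatrix P × IsDiagonal D × Nonsingular D × A ≈ᴹ (P ·ᴹ D))

  diag : ∀ {m} → Vector m → Matrix m m
  diag d i j = d i * δ i j

  diag-isDiagonal : ∀ {m} (d : Vector m) → IsDiagonal (diag d)
  diag-isDiagonal d i j i≢j = trans (*-congˡ (δ-≢ i≢j)) (zeroʳ (d i))

  diagonal≈diag : ∀ {m} {D : Matrix m m} → IsDiagonal D → ∀ i j → D i j ≈ D i i * δ i j
  diagonal≈diag D-diag i = supported-at i (λ k k≢i → D-diag i k (k≢i ∘ ≡.sym))

  monomial-·ᵛ : ∀ {m} {ρ a} {A : Matrix m m} → IsMonomial ρ a A → ∀ x i → (A ·ᵛ x) i ≈ a i * x (ρ i)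
  monomial-·ᵛ {ρ = ρ} {a} A≈ x i = trans (∑-cong _ (λ k → *-congʳ (A≈ i k))) (∑-scaled-δ (a i) (ρ i) x)

  permutation-·ᴹ : ∀ {m n} {ρ : Fin m → Fin m} {P : Matrix m m} → (∀ i j → P i j ≈ δ (ρ i) j) →
                   ∀ (M : Matrix m n) i j → (P ·ᴹ M) i j ≈ M (ρ i) j
  permutation-·ᴹ {ρ = ρ} P≈ M i j = trans (∑-cong _ (λ k → *-congʳ (P≈ i k))) (∑-δ (ρ i) (λ k → M k j))

  diagonal-·ᴹ : ∀ {m n} {D : Matrix m m} → IsDiagonal D →
                ∀ (M : Matrix m n) i j → (D ·ᴹ M) i j ≈ D i i * M i j
  diagonal-·ᴹ D-diag M i j =
    trans (∑-cong _ (λ k → *-congʳ (diagonal≈diag D-diag i k))) (∑-scaled-δ _ i (λ k → M k j))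

  diag-inverse : ∀ {m} (d e : Vector m) → (∀ i → d i * e i ≈ 1#) → (diag d ·ᴹ diag e) ≈ᴹ I
  diag-inverse d e de≈1 i j = begin
    (diag d ·ᴹ diag e) i j         ≈⟨ diagonal-·ᴹ (diag-isDiagonal d) (diag e) i j ⟩
    (d i * δ i i) * (e i * δ i j)  ≈⟨ *-congʳ (trans (*-congˡ (δ-refl i)) (*-identityʳ (d i))) ⟩
    d i * (e i * δ i j)            ≈⟨ *-assoc (d i) (e i) (δ i j) ⟨
    (d i * e i) * δ i j            ≈⟨ *-congʳ (de≈1 i) ⟩
    1# * δ i j                     ≈⟨ *-identityˡ (δ i j) ⟩
    δ i j                          ∎

  diag-nonsingular : ∀ {m} (d : Vector m) → (∀ i → ¬ d i ≈ 0#) → Nonsingular (diag d)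
  diag-nonsingular d d≉0 = diag d⁻¹ , diag-inverse d d⁻¹ dd⁻¹≈1
                         , diag-inverse d⁻¹ d (λ i → trans (*-comm _ (d i)) (dd⁻¹≈1 i))
    where
    d⁻¹ : Vector _
    d⁻¹ i = inv (d i) (d≉0 i)
    dd⁻¹≈1 : ∀ i → d i * d⁻¹ i ≈ 1#
    dd⁻¹≈1 i = *-inverseʳ (d i) (d≉0 i)

  monomial⇒permutationTimesDiagonal : ∀ {m} {A : Matrix m m} → Monomial A → PermutationTimesDiagonal A
  monomial⇒permutationTimesDiagonal {A = A} (π , a , a≉0 , A≈) =
    P , diag d , (π , λ i j → refl) , diag-isDiagonal d , diag-nonsingular d (λ k → a≉0 (π ⟨$⟩ˡ k)) , A≈PD
    where
    P : Matrix _ _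
    P i j = δ (π ⟨$⟩ʳ i) j
    d : Vector _
    d k = a (π ⟨$⟩ˡ k)
    A≈PD : A ≈ᴹ (P ·ᴹ diag d)
    A≈PD i j = begin
      A i j                             ≈⟨ A≈ i j ⟩
      a i * δ (π ⟨$⟩ʳ i) j              ≡⟨ ≡.cong (λ l → a l * δ (π ⟨$⟩ʳ i) j) (inverseˡ π) ⟨
      diag d (π ⟨$⟩ʳ i) j               ≈⟨ permutation-·ᴹ {ρ = π ⟨$⟩ʳ_} (λ _ _ → refl) (diag d) i j ⟨
      (P ·ᴹ diag d) i j                 ∎

  permutationTimesDiagonal⇒monomial : ∀ {m} {A : Matrix m m} → PermutationTimesDiagonal A → Monomial A
  permutationTimesDiagonal⇒monomial {A = A} (P , D , (π , P≈) , D-diag , (E , DE≈I , _) , A≈PD) =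
    π , (λ i → D (ρ i) (ρ i)) , (λ i → D-invertible (ρ i)) , A≈
    where
    ρ : Fin _ → Fin _
    ρ = π ⟨$⟩ʳ_
    D-invertible : ∀ j → ¬ D j j ≈ 0#
    D-invertible j = x*y≈1⇒x≉0 (trans (sym (diagonal-·ᴹ D-diag E j j)) (trans (DE≈I j j) (δ-refl j)))
    A≈ : IsMonomial ρ (λ i → D (ρ i) (ρ i)) A
    A≈ i j = trans (A≈PD i j) (trans (permutation-·ᴹ {ρ = ρ} P≈ D i j) (diagonal≈diag D-diag (ρ i) j))

  monomial⇒mapsTorusOnto : ∀ {m} {A : Matrix m m} {b : Vector m} → Monomial A → b ≈ᵛ 0ᵛ → MapsTorusOnto A b
  monomial⇒mapsTorusOnto {A = A} {b} (π , a , a≉0 , A≈) b≈0 = into , onto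
    where
    ρ : Fin _ → Fin _
    ρ = π ⟨$⟩ʳ_
    T≈ : ∀ x i → affine A b x i ≈ a i * x (ρ i)
    T≈ x i = trans (+-cong (monomial-·ᵛ {ρ = ρ} A≈ x i) (b≈0 i)) (+-identityʳ _)
    into : ∀ x → InTorus x → InTorus (affine A b x)
    into x x∈T i Tx≈0 = *-nonzero (a≉0 i) (x∈T (ρ i)) (trans (sym (T≈ x i)) Tx≈0)
    onto : ∀ y → InTorus y → ∃[ x ] (InTorus x × affine A b x ≈ᵛ y)
    onto y y∈T = (λ k → z (π ⟨$⟩ˡ k)) , (λ k → *-nonzero (inv≉0 _ _) (y∈T _)) , λ i → begin
      affine A b (λ k → z (π ⟨$⟩ˡ k)) i  ≈⟨ T≈ _ i ⟩
      a i * z (π ⟨$⟩ˡ (ρ i))             ≡⟨ ≡.cong (λ l → a i * z l) (inverseˡ π) ⟩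
      a i * z i                          ≈⟨ *-inv-cancel (a≉0 i) (y i) ⟩
      y i                                ∎
      where
      z : Vector _
      z j = inv (a j) (a≉0 j) * y j

  1ᵛ : ∀ {m} → Vector m
  1ᵛ _ = 1#

  1ᵛ∈T : ∀ {m} → InTorus (1ᵛ {m})
  1ᵛ∈T _ = 1≉0

  shift : ∀ {m} → Vector m → Fin m → Carrier → Vector m
  shift x s t k = x k + δ s k * t

  shift-≡ : ∀ {m} (x : Vector m) s t → shift x s t s ≈ x s + t
  shift-≡ x s t = +-congˡ (trans (*-congʳ (δ-refl s)) (*-identityˡ t))

  shift-≢ : ∀ {m} (x : Vector m) {s k} t → k ≢ s → shift x s t k ≈ x k
  shift-≢ x t k≢s = trans (+-congˡ (trans (*-congʳ (δ-≢ (k≢s ∘ ≡.sym))) (zeroˡ t))) (+-identityʳ _)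

  shift∈T : ∀ {m} {x : Vector m} {s t} → InTorus x → ¬ x s + t ≈ 0# → InTorus (shift x s t)
  shift∈T {x = x} {s} {t} x∈T xs+t≉0 k with k ≟ s
  ... | yes ≡.refl = xs+t≉0 ∘ trans (sym (shift-≡ x s t))
  ... | no  k≢s    = x∈T k ∘ trans (sym (shift-≢ x t k≢s))

  onesWith : ∀ {m} → Fin m → Carrier → Vector m
  onesWith i u = shift 1ᵛ i (u - 1#)

  1+[u-1]≈u : ∀ u → 1# + (u - 1#) ≈ u
  1+[u-1]≈u u = trans (+-comm 1# _) (//-rightDividesˡ 1# u)

  onesWith-≡ : ∀ {m} (i : Fin m) u → onesWith i u i ≈ u
  onesWith-≡ i u = trans (shift-≡ 1ᵛ i (u - 1#)) (1+[u-1]≈u u)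

  onesWith-≢ : ∀ {m} {i k : Fin m} u → k ≢ i → onesWith i u k ≈ 1#
  onesWith-≢ u = shift-≢ 1ᵛ (u - 1#)

  onesWith∈T : ∀ {m} (i : Fin m) {u} → ¬ u ≈ 0# → InTorus (onesWith i u)
  onesWith∈T i {u} u≉0 = shift∈T {s = i} 1ᵛ∈T (u≉0 ∘ trans (sym (1+[u-1]≈u u)))

  module NonvanishingForm {n} (a : Vector n) (c : Carrier)
    (nonvanishing : ∀ x → InTorus x → ¬ ∑ n (λ k → a k * x k) + c ≈ 0#) where

    form : Vector n → Carrier
    form x = ∑ n (λ k → a k * x k) + c

    form-shift : ∀ x s t → form (shift x s t) ≈ form x + a s * t
    form-shift x s t = begin
      ∑ n (λ k → a k * (x k + δ s k * t)) + c
        ≈⟨ +-congʳ (∑-cong n (λ k → distribˡ (a k) (x k) _)) ⟩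
      ∑ n (λ k → a k * x k + a k * (δ s k * t)) + c
        ≈⟨ +-congʳ (∑-distrib-+ n _ _) ⟩
      (∑ n (λ k → a k * x k) + ∑ n (λ k → a k * (δ s k * t))) + c
        ≈⟨ +-congʳ (+-congˡ (trans (∑-cong n (λ k → x∙yz≈y∙xz (a k) (δ s k) t)) (∑-δ s (λ k → a k * t)))) ⟩
      (∑ n (λ k → a k * x k) + a s * t) + c
        ≈⟨ +-xy∙z≈xz∙y _ (a s * t) c ⟩
      form x + a s * t ∎

    -- Otherwise shifting x_s by t with a_s t = -form x stays in the torus and kills the form.
    form≈monomial : ∀ {s} → ¬ a s ≈ 0# → ∀ {x} → InTorus x → form x ≈ a s * x s
    form≈monomial {s} as≉0 {x} x∈T = decidable-stable (_≈?_ (form x) (a s * x s)) λ form≉asxs →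
      nonvanishing (shift x s t) (shift∈T x∈T (form≉asxs ∘ form≈asxs)) form-shifted≈0
      where
      t : Carrier
      t = inv (a s) as≉0 * - form x
      ast≈-form : a s * t ≈ - form x
      ast≈-form = *-inv-cancel as≉0 (- form x)
      form-shifted≈0 : form (shift x s t) ≈ 0#
      form-shifted≈0 = trans (form-shift x s t) (trans (+-congˡ ast≈-form) (-‿inverseʳ (form x)))
      form≈asxs : x s + t ≈ 0# → form x ≈ a s * x s
      form≈asxs xs+t≈0 = begin
        form x              ≈⟨ -‿involutive (form x) ⟨
        - - form x          ≈⟨ -‿cong ast≈-form ⟨
        - (a s * t)         ≈⟨ +-inverseˡ-unique (a s * x s) (a s * t) as[xs+t]≈0 ⟨
        a s * x s           ∎
        where
        as[xs+t]≈0 : a s * x s + a s * t ≈ 0#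
        as[xs+t]≈0 = trans (sym (distribˡ (a s) (x s) t)) (trans (*-congˡ xs+t≈0) (zeroʳ (a s)))

    -- Moving one coordinate from 1 to u ∉ {0, 1} changes the form by a_k (u - 1).
    support-unique : 3 ≤ size → ∀ {s} → ¬ a s ≈ 0# → ∀ k → k ≢ s → a k ≈ 0#
    support-unique q≥3 {s} as≉0 k k≢s with nonzero-avoiding q≥3 1#
    ... | u , u≉0 , u≉1 = decidable-stable (a k ≈? 0#) λ ak≉0 →
      u≉1 (x∙y⁻¹≈ε⇒x≈y u 1# (x*y≈0⇒y≈0 ak≉0 (+-identityʳ-unique (form 1ᵛ) _ (begin
        form 1ᵛ + a k * (u - 1#)  ≈⟨ form-shift 1ᵛ k (u - 1#) ⟨
        form (onesWith k u)       ≈⟨ form≈monomial as≉0 (onesWith∈T k u≉0) ⟩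
        a s * onesWith k u s      ≈⟨ *-congˡ (onesWith-≢ u (k≢s ∘ ≡.sym)) ⟩
        a s * 1#                  ≈⟨ form≈monomial as≉0 1ᵛ∈T ⟨
        form 1ᵛ                   ∎))))

    constant-vanishes : 3 ≤ size → ∀ {s} → ¬ a s ≈ 0# → c ≈ 0#
    constant-vanishes q≥3 {s} as≉0 = +-identityʳ-unique (a s * 1#) c (begin
      a s * 1# + c                   ≈⟨ +-congʳ (∑-single-support s a≈0) ⟨
      form 1ᵛ                        ≈⟨ form≈monomial as≉0 1ᵛ∈T ⟩
      a s * 1#                       ∎)
      where
      a≈0 : ∀ k → k ≢ s → a k * 1# ≈ 0#
      a≈0 k k≢s = trans (*-congʳ (support-unique q≥3 as≉0 k k≢s)) (zeroˡ 1#)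

  module FromMapsTorusOnto (q≥3 : 3 ≤ size) {m} {A : Matrix m m} {b : Vector m}
    (T-onto : MapsTorusOnto A b) where

    onto : ∀ y → InTorus y → ∃[ x ] (InTorus x × affine A b x ≈ᵛ y)
    onto = proj₂ T-onto

    module Row (i : Fin m) = NonvanishingForm (A i) (b i) (λ x x∈T → proj₁ T-onto x x∈T i)

    -- a zero row would make the i-th coordinate of the image the constant b_i
    zero-row-impossible : ∀ i → ¬ (∀ s → A i s ≈ 0#)
    zero-row-impossible i row≈0 with nonzero-avoiding q≥3 (b i)
    ... | u , u≉0 , u≉bi with onto (onesWith i u) (onesWith∈T i u≉0)
    ...   | x , _ , Tx≈y = u≉bi (begin
      u                              ≈⟨ onesWith-≡ i u ⟨
      onesWith i u i                 ≈⟨ Tx≈y i ⟨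
      (A ·ᵛ x) i + b i               ≈⟨ +-congʳ (∑-zero m (λ k → trans (*-congʳ (row≈0 k)) (zeroˡ (x k)))) ⟩
      0# + b i                       ≈⟨ +-identityˡ (b i) ⟩
      b i                            ∎)

    row-support : ∀ i → ∃[ s ] ¬ A i s ≈ 0#
    row-support i = ¬∀⟶∃¬ m _ (λ s → A i s ≈? 0#) (zero-row-impossible i)

    σ : Fin m → Fin m
    σ i = proj₁ (row-support i)

    σ-nonzero : ∀ i → ¬ A i (σ i) ≈ 0#
    σ-nonzero i = proj₂ (row-support i)

    -- rows i ≠ i′ sharing a column s satisfy y_i′ = (A_i′s / A_is) y_i on the whole image
    shared-column⇒constant-ratio : ∀ {i i′} → i ≢ i′ → σ i ≡ σ i′ →
      ∀ {u} → ¬ u ≈ 0# → u ≈ A i′ (σ i) * inv (A i (σ i)) (σ-nonzero i)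
    shared-column⇒constant-ratio {i} {i′} i≢i′ σi≡σi′ {u} u≉0 with onto (onesWith i′ u) (onesWith∈T i′ u≉0)
    ... | x , x∈T , Tx≈y = begin
      u                       ≈⟨ onesWith-≡ i′ u ⟨
      onesWith i′ u i′        ≈⟨ Tx≈y i′ ⟨
      affine A b x i′         ≈⟨ Row.form≈monomial i′ β≉0 x∈T ⟩
      A i′ s * x s            ≈⟨ *-congˡ (x*y≈1⇒y≈inv (σ-nonzero i) αxs≈1) ⟩
      A i′ s * inv (A i s) _  ∎
      where
      s : Fin m
      s = σ i
      β≉0 : ¬ A i′ s ≈ 0#
      β≉0 = ≡.subst (λ j → ¬ A i′ j ≈ 0#) (≡.sym σi≡σi′) (σ-nonzero i′)
      αxs≈1 : A i s * x s ≈ 1#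
      αxs≈1 = begin
        A i s * x s      ≈⟨ Row.form≈monomial i (σ-nonzero i) x∈T ⟨
        affine A b x i   ≈⟨ Tx≈y i ⟩
        onesWith i′ u i  ≈⟨ onesWith-≢ u i≢i′ ⟩
        1#               ∎

    σ-injective : Injective _≡_ _≡_ σ
    σ-injective {i} {i′} σi≡σi′ with i ≟ i′
    ... | yes i≡i′ = i≡i′
    ... | no  i≢i′ with nonzero-avoiding q≥3 (A i′ (σ i) * inv (A i (σ i)) (σ-nonzero i))
    ...   | u , u≉0 , u≉ratio = ⊥-elim (u≉ratio (shared-column⇒constant-ratio i≢i′ σi≡σi′ u≉0))

    σ-permutation : Permutation′ m
    σ-permutation = permutation σ σ⁻¹ σσ⁻¹ (λ i → σ-injective (σσ⁻¹ (σ i)))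
      where
      σ⁻¹ : Fin m → Fin m
      σ⁻¹ k = proj₁ (injective⇒surjective σ-injective k)
      σσ⁻¹ : ∀ k → σ (σ⁻¹ k) ≡ k
      σσ⁻¹ k = proj₂ (injective⇒surjective σ-injective k) ≡.refl

    b≈0 : b ≈ᵛ 0ᵛ
    b≈0 i = Row.constant-vanishes i q≥3 (σ-nonzero i)

    A-monomial : Monomial A
    A-monomial = σ-permutation , (λ i → A i (σ i)) , σ-nonzero
               , λ i → supported-at (σ i) (Row.support-unique i q≥3 (σ-nonzero i))

corollary1 : ∀ {c ℓ} (F : FiniteField c ℓ) → 3 ≤ FiniteField.size F →
    let open LinAlg F in
    (m : ℕ) (A : Matrix m m) (b : Vector m) →
    MapsTorusOnto A b ⇔
      (b ≈ᵛ 0ᵛ × ∃[ P ] ∃[ D ] (IsPermutationMatrix P × IsDiagonal D × Nonsingular D × A ≈ᴹ (P ·ᴹ D)))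
corollary1 F q≥3 m A b = mk⇔
  (λ T-onto → let open FromMapsTorusOnto F q≥3 {A = A} {b} T-onto in
              b≈0 , monomial⇒permutationTimesDiagonal F A-monomial)
  (λ (b≈0 , A≈PD) → monomial⇒mapsTorusOnto F (permutationTimesDiagonal⇒monomial F A≈PD) b≈0)
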